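{- For every formula $\varphi\in F$: $\mathsf{RBB}_\sigma^+\vdash B\varphi\leftrightarrow\sigma:\varphi$.
   Context: $P$ (propositional letters) and $R$ (reason symbols) are nonempty sets, with $R$ containing a distinguished symbol $\sigma$. $F$: $\varphi ::= p \mid \neg\varphi \mid (\varphi\lor\varphi) \mid (r:\varphi) \mid r \mid B\varphi$, $p\in P$, $r\in R$. $\mathsf{RBB}$ has axiom schemes (CL) classical propositional tautologies; (RK) $r:(\varphi\to\psi)\to(r:\varphi\to r:\psi)$; (A) $r:\varphi\to(r\to\varphi)$; (RB) $r:\varphi\to(Br\to B\varphi)$; (D) $B\varphi\to\neg B\neg\varphi$; rules (MP) modus ponens, (RN) from $\varphi$ infer $r:\varphi$, (E) from $\varphi\leftrightarrow\psi$ infer $B\varphi\leftrightarrow B\psi$. $\mathsf{RBB}_\sigma^+$ is $\mathsf{RBB}$ plus the schemes (MA) $\sigma\to(Br\to r)$, (MB) $B\sigma$, (MR) $r:\varphi\to(Br\to\sigma:\varphi)$, (MT) $B\varphi\to\sigma:\varphi$, for all $r\in R$, $\varphi\in F$. -}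

module Defs where

open import Data.Bool using (Bool; true; false; not; _∨_)
open import Relation.Binary.PropositionalEquality using (_≡_)

data Fm (P R : Set) : Set where
  atom  : P → Fm P R
  ¬'_   : Fm P R → Fm P R
  _∨'_  : Fm P R → Fm P R → Fm P R
  _∶_   : R → Fm P R → Fm P R
  rs    : R → Fm P R
  B     : Fm P R → Fm P R

infixr 9 ¬'_
infixr 6 _∶_
infixl 5 _∨'_

module _ {P R : Set} where

  _→'_ : Fm P R → Fm P R → Fm P R
  φ →' ψ = ¬' φ ∨' ψ

  _∧'_ : Fm P R → Fm P R → Fm P R
  φ ∧' ψ = ¬' (¬' φ ∨' ¬' ψ)

  _↔'_ : Fm P R → Fm P R → Fm P R
  φ ↔' ψ = (φ →' ψ) ∧' (ψ →' φ)

  infixr 4 _→'_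
  infixr 3 _↔'_

  -- Truth-functional evaluation: all formulas whose main connective is not
  -- ¬ or ∨ (i.e. p, r:φ, r, Bφ) are treated as propositional atoms.
  ev : (Fm P R → Bool) → Fm P R → Bool
  ev v (atom p) = v (atom p)
  ev v (¬' φ)   = not (ev v φ)
  ev v (φ ∨' ψ) = ev v φ ∨ ev v ψ
  ev v (r ∶ φ)  = v (r ∶ φ)
  ev v (rs r)   = v (rs r)
  ev v (B φ)    = v (B φ)

  Taut : Fm P R → Set
  Taut φ = (v : Fm P R → Bool) → ev v φ ≡ true

data ⊢RBBσ⁺ {P R : Set} (σ : R) : Fm P R → Set where
  CL : ∀ {φ} → Taut φ → ⊢RBBσ⁺ σ φ
  RK : ∀ r φ ψ → ⊢RBBσ⁺ σ ((r ∶ (φ →' ψ)) →' ((r ∶ φ) →' (r ∶ ψ)))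
  A  : ∀ r φ → ⊢RBBσ⁺ σ ((r ∶ φ) →' (rs r →' φ))
  RB : ∀ r φ → ⊢RBBσ⁺ σ ((r ∶ φ) →' (B (rs r) →' B φ))
  D  : ∀ φ → ⊢RBBσ⁺ σ (B φ →' ¬' B (¬' φ))
  MA : ∀ r → ⊢RBBσ⁺ σ (rs σ →' (B (rs r) →' rs r))
  MB : ⊢RBBσ⁺ σ (B (rs σ))
  MR : ∀ r φ → ⊢RBBσ⁺ σ ((r ∶ φ) →' (B (rs r) →' (σ ∶ φ)))
  MT : ∀ φ → ⊢RBBσ⁺ σ (B φ →' (σ ∶ φ))
  MP : ∀ {φ ψ} → ⊢RBBσ⁺ σ (φ →' ψ) → ⊢RBBσ⁺ σ φ → ⊢RBBσ⁺ σ ψ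
  RN : ∀ {φ} r → ⊢RBBσ⁺ σ φ → ⊢RBBσ⁺ σ (r ∶ φ)
  E  : ∀ {φ ψ} → ⊢RBBσ⁺ σ (φ ↔' ψ) → ⊢RBBσ⁺ σ (B φ ↔' B ψ)

module Submission where

-- The two directions of  Bφ ↔ σ:φ  come from the axioms directly:
--   (→) is the instance (MT) Bφ → σ:φ;
--   (←) follows from (RB) for the reason σ, namely  σ:φ → (Bσ → Bφ),
--       by discharging the antecedent Bσ with the axiom (MB).

open import Defs
open import Data.Bool using (Bool; true; false; not; _∨_)
open import Relation.Binary.PropositionalEquality using (_≡_; refl)

module _ {P R : Set} {σ : R} where

  exchange-taut : (ψ χ φ : Fm P R) →
    Taut ((ψ →' (χ →' φ)) →' (χ →' (ψ →' φ)))
  exchange-taut ψ χ φ v = bool (ev v ψ) (ev v χ) (ev v φ)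
    where
    bool : (a b c : Bool) →
      not (not a ∨ (not b ∨ c)) ∨ (not b ∨ (not a ∨ c)) ≡ true
    bool false false false = refl
    bool false false true  = refl
    bool false true  false = refl
    bool false true  true  = refl
    bool true  false false = refl
    bool true  false true  = refl
    bool true  true  false = refl
    bool true  true  true  = refl

  iff-taut : (φ ψ : Fm P R) → Taut ((φ →' ψ) →' ((ψ →' φ) →' (φ ↔' ψ)))
  iff-taut φ ψ v = bool (ev v φ) (ev v ψ)
    where
    bool : (a b : Bool) →
      not (not a ∨ b) ∨ (not (not b ∨ a) ∨
        not (not (not a ∨ b) ∨ not (not b ∨ a))) ≡ true
    bool false false = refl
    bool false true  = refl
    bool true  false = refl
    bool true  true  = refl

  discharge : {ψ χ φ : Fm P R} →
    ⊢RBBσ⁺ σ (ψ →' (χ →' φ)) → ⊢RBBσ⁺ σ χ → ⊢RBBσ⁺ σ (ψ →' φ)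
  discharge {ψ} {χ} {φ} ⊢ψχφ ⊢χ = MP (MP (CL (exchange-taut ψ χ φ)) ⊢ψχφ) ⊢χ

  iff-intro : {φ ψ : Fm P R} →
    ⊢RBBσ⁺ σ (φ →' ψ) → ⊢RBBσ⁺ σ (ψ →' φ) → ⊢RBBσ⁺ σ (φ ↔' ψ)
  iff-intro {φ} {ψ} ⊢φψ ⊢ψφ = MP (MP (CL (iff-taut φ ψ)) ⊢φψ) ⊢ψφ

mainTheorem16 : {P R : Set} → P → (σ : R) → (φ : Fm P R) →
    ⊢RBBσ⁺ σ (B φ ↔' (σ ∶ φ))
mainTheorem16 _ σ φ = iff-intro belief⇒σ σ⇒belief
  where
  belief⇒σ : ⊢RBBσ⁺ σ (B φ →' (σ ∶ φ))
  belief⇒σ = MT φ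

  σ⇒belief : ⊢RBBσ⁺ σ ((σ ∶ φ) →' B φ)
  σ⇒belief = discharge (RB σ φ) MB
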